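{- For any $\Sigma\cup\{\alpha,\beta\}\subseteq\mathit{Fm}$: (i) if $\Sigma\cup\{\alpha\}\vdash_{\mathrm{HIPWK}}\beta$ then $\Sigma\vdash_{\mathrm{HIPWK}}\alpha\longrightarrow\beta$; (ii) if $\Sigma\vdash_{\mathrm{HIPWK}}\alpha\longrightarrow\beta$ and $\mathrm{var}(\alpha)\subseteq\mathrm{var}(\beta)$, then $\Sigma\cup\{\alpha\}\vdash_{\mathrm{HIPWK}}\beta$.
   Context: Formulas $\mathit{Fm}$ are built over a countably infinite set $V$ of variables in the language $\{\land,\lor,\longrightarrow,\neg,0,1\}$. $\mathrm{var}(\varphi)$ is the set of variables in $\varphi$. HIPWK is the Hilbert-style logic (derivations from hypotheses $\Sigma$ as finite sequences of axiom instances, hypotheses, and rule applications) with axiom schemes (A1) $\alpha\longrightarrow(\beta\longrightarrow\alpha)$; (A2) $(\alpha\longrightarrow(\beta\longrightarrow\gamma))\longrightarrow((\alpha\longrightarrow\beta)\longrightarrow(\alpha\longrightarrow\gamma))$; (A3) $\alpha\longrightarrow(\beta\longrightarrow(\alpha\land\beta))$; (A4) $\alpha\land\beta\longrightarrow\alpha$; (A5) $\alpha\land\beta\longrightarrow\beta$; (A6) $\alpha\longrightarrow\alpha\lor\beta$; (A7) $\beta\longrightarrow\alpha\lor\beta$; (A8) $(\alpha\longrightarrow\gamma)\longrightarrow((\beta\longrightarrow\gamma)\longrightarrow(\alpha\lor\beta\longrightarrow\gamma))$; (A9) $(\alpha\longrightarrow\beta)\longrightarrow((\alpha\longrightarrow\neg\beta)\longrightarrow\neg\alpha)$;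 (A10) $0\longrightarrow\alpha$, and the single rule $\frac{\alpha,\ \alpha\longrightarrow\beta}{\beta}$ provided $\mathrm{var}(\alpha)\subseteq\mathrm{var}(\beta)$. -}

module Defs where

open import Data.Nat using (ℕ)
open import Data.List using (List; []; _∷_)
open import Data.List.Membership.Propositional using (_∈_)
open import Data.Product using (∃; _×_)
open import Data.Sum using (_⊎_)
open import Relation.Binary.PropositionalEquality using (_≡_)

data Fm : Set where
  var  : ℕ → Fm
  _∧_  : Fm → Fm → Fm
  _∨_  : Fm → Fm → Fm
  _⟶_  : Fm → Fm → Fm
  ¬'_  : Fm → Fm
  𝟘 𝟙  : Fm

infixr 5 _⟶_
infixr 6 _∨_
infixr 7 _∧_
infix 8 ¬'_

data _∈var_ (x : ℕ) : Fm → Set where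
  here : x ∈var var x
  ∧l : ∀ {a b} → x ∈var a → x ∈var (a ∧ b)
  ∧r : ∀ {a b} → x ∈var b → x ∈var (a ∧ b)
  ∨l : ∀ {a b} → x ∈var a → x ∈var (a ∨ b)
  ∨r : ∀ {a b} → x ∈var b → x ∈var (a ∨ b)
  ⟶l : ∀ {a b} → x ∈var a → x ∈var (a ⟶ b)
  ⟶r : ∀ {a b} → x ∈var b → x ∈var (a ⟶ b)
  ¬i : ∀ {a} → x ∈var a → x ∈var (¬' a)

_⊆var_ : Fm → Fm → Set
α ⊆var β = ∀ x → x ∈var α → x ∈var β

data Axiom : Fm → Set where
  A1  : ∀ α β → Axiom (α ⟶ (β ⟶ α))
  A2  : ∀ α β γ → Axiom ((α ⟶ (β ⟶ γ)) ⟶ ((α ⟶ β) ⟶ (α ⟶ γ)))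
  A3  : ∀ α β → Axiom (α ⟶ (β ⟶ (α ∧ β)))
  A4  : ∀ α β → Axiom ((α ∧ β) ⟶ α)
  A5  : ∀ α β → Axiom ((α ∧ β) ⟶ β)
  A6  : ∀ α β → Axiom (α ⟶ (α ∨ β))
  A7  : ∀ α β → Axiom (β ⟶ (α ∨ β))
  A8  : ∀ α β γ → Axiom ((α ⟶ γ) ⟶ ((β ⟶ γ) ⟶ ((α ∨ β) ⟶ γ)))
  A9  : ∀ α β → Axiom ((α ⟶ β) ⟶ ((α ⟶ ¬' β) ⟶ ¬' α))
  A10 : ∀ α → Axiom (𝟘 ⟶ α)

FmSet : Set₁
FmSet = Fm → Set

_,,_ : FmSet → Fm → FmSet
(Σ' ,, α) φ = Σ' φ ⊎ (φ ≡ α)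

data Justified (Σ' : FmSet) (prev : List Fm) (φ : Fm) : Set where
  ax  : Axiom φ → Justified Σ' prev φ
  hyp : Σ' φ → Justified Σ' prev φ
  mp  : ∀ α → α ∈ prev → (α ⟶ φ) ∈ prev → α ⊆var φ → Justified Σ' prev φ

-- A derivation from Σ, stored in reverse order (head = last formula).
data Derivation (Σ' : FmSet) : List Fm → Set where
  nil  : Derivation Σ' []
  snoc : ∀ {prev φ} → Derivation Σ' prev → Justified Σ' prev φ → Derivation Σ' (φ ∷ prev)

_⊢_ : FmSet → Fm → Set
Σ' ⊢ φ = ∃ λ prev → Derivation Σ' (φ ∷ prev)

infix 3 _⊢_

-- Derivations are first turned into proof trees, where the variable-restricted
-- modus ponens is a constructor.  The deduction theorem is then the usual
-- induction via (A1) and (A2): the variable side condition survives because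
-- if var(γ) ⊆ var(β) then var(α → γ) ⊆ var(α → β), and the premise of the
-- last (A2) step has no variables beyond those of its conclusion.  Conversely,
-- from α → β one gets β over Σ ∪ {α} by a single restricted modus ponens.
module Submission where

open import Defs
open import Data.Product using (_×_; _,_)
open import Data.Sum using (inj₁; inj₂)
open import Data.List using (List; []; _∷_; _++_)
open import Data.List.Membership.Propositional using (_∈_)
open import Data.List.Membership.Propositional.Properties using (∈-++⁺ˡ; ∈-++⁺ʳ)
open import Data.List.Relation.Unary.All using (All; []; _∷_; lookup)
open import Data.List.Relation.Unary.Any using (here)
open import Relation.Binary.PropositionalEquality using (refl)

infix 3 _⊢ₜ_

data _⊢ₜ_ (Σ' : FmSet) : Fm → Set where
  axiom      : ∀ {φ} → Axiom φ → Σ' ⊢ₜ φ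
  assumption : ∀ {φ} → Σ' φ → Σ' ⊢ₜ φ
  mp         : ∀ {α φ} → Σ' ⊢ₜ α → Σ' ⊢ₜ α ⟶ φ → α ⊆var φ → Σ' ⊢ₜ φ

⟶-monoʳ-⊆var : ∀ {α γ β} → γ ⊆var β → (α ⟶ γ) ⊆var (α ⟶ β)
⟶-monoʳ-⊆var γ⊆β x (⟶l p) = ⟶l p
⟶-monoʳ-⊆var γ⊆β x (⟶r p) = ⟶r (γ⊆β x p)

A2-premise-⊆var : ∀ α γ β → (α ⟶ (γ ⟶ β)) ⊆var ((α ⟶ γ) ⟶ (α ⟶ β))
A2-premise-⊆var α γ β x (⟶l p)      = ⟶l (⟶l p)
A2-premise-⊆var α γ β x (⟶r (⟶l p)) = ⟶l (⟶r p)
A2-premise-⊆var α γ β x (⟶r (⟶r p)) = ⟶r (⟶r p)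

derivation⇒trees : ∀ {Σ' l} → Derivation Σ' l → All (Σ' ⊢ₜ_) l
derivation⇒trees nil                             = []
derivation⇒trees (snoc d (ax a))                 = axiom a ∷ derivation⇒trees d
derivation⇒trees (snoc d (hyp h))                = assumption h ∷ derivation⇒trees d
derivation⇒trees (snoc d (Justified.mp α p q s)) =
  mp (lookup ts p) (lookup ts q) s ∷ ts
  where ts = derivation⇒trees d

⊢⇒⊢ₜ : ∀ {Σ' φ} → Σ' ⊢ φ → Σ' ⊢ₜ φ
⊢⇒⊢ₜ (_ , d) with derivation⇒trees d
... | t ∷ _ = t

Justified-++ : ∀ {Σ' prev φ} (l : List Fm) → Justified Σ' prev φ → Justified Σ' (prev ++ l) φ
Justified-++ l (ax a)                 = ax a
Justified-++ l (hyp h)                = hyp h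
Justified-++ l (Justified.mp α p q s) = Justified.mp α (∈-++⁺ˡ p) (∈-++⁺ˡ q) s

Derivation-++ : ∀ {Σ' l₁ l₂} → Derivation Σ' l₁ → Derivation Σ' l₂ → Derivation Σ' (l₂ ++ l₁)
Derivation-++ d₁ nil                   = d₁
Derivation-++ {l₁ = l₁} d₁ (snoc d₂ j) = snoc (Derivation-++ d₁ d₂) (Justified-++ l₁ j)

⊢ₜ⇒⊢ : ∀ {Σ' φ} → Σ' ⊢ₜ φ → Σ' ⊢ φ
⊢ₜ⇒⊢ (axiom a)      = [] , snoc nil (ax a)
⊢ₜ⇒⊢ (assumption h) = [] , snoc nil (hyp h)
⊢ₜ⇒⊢ {φ = φ} (mp {α} tα tαφ s) with ⊢ₜ⇒⊢ tα | ⊢ₜ⇒⊢ tαφ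
... | l₁ , d₁ | l₂ , d₂ =
  _ , snoc (Derivation-++ d₁ d₂)
           (Justified.mp α (∈-++⁺ʳ ((α ⟶ φ) ∷ l₂) (here refl)) (here refl) s)

weaken : ∀ {Σ' α φ} → Σ' ⊢ₜ φ → (Σ' ,, α) ⊢ₜ φ
weaken (axiom a)      = axiom a
weaken (assumption h) = assumption (inj₁ h)
weaken (mp t u s)     = mp (weaken t) (weaken u) s

⟶-intro-const : ∀ {Σ'} α {β} → Σ' ⊢ₜ β → Σ' ⊢ₜ α ⟶ β
⟶-intro-const α {β} t = mp t (axiom (A1 β α)) (λ _ → ⟶r)

mp-under : ∀ {Σ'} α {γ β} → Σ' ⊢ₜ α ⟶ γ → Σ' ⊢ₜ α ⟶ (γ ⟶ β) → γ ⊆var β → Σ' ⊢ₜ α ⟶ β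
mp-under α {γ} {β} tγ tγβ γ⊆β =
  mp tγ (mp tγβ (axiom (A2 α γ β)) (A2-premise-⊆var α γ β)) (⟶-monoʳ-⊆var γ⊆β)

⊢ₜ-identity : ∀ {Σ'} α → Σ' ⊢ₜ α ⟶ α
⊢ₜ-identity α = mp-under α (axiom (A1 α α)) (axiom (A1 α (α ⟶ α))) α⟶α⊆α
  where
  α⟶α⊆α : (α ⟶ α) ⊆var α
  α⟶α⊆α x (⟶l p) = p
  α⟶α⊆α x (⟶r p) = p

deduction : ∀ {Σ' α β} → (Σ' ,, α) ⊢ₜ β → Σ' ⊢ₜ α ⟶ β
deduction {α = α} (axiom a)                = ⟶-intro-const α (axiom a)
deduction {α = α} (assumption (inj₁ h))    = ⟶-intro-const α (assumption h)
deduction {α = α} (assumption (inj₂ refl)) = ⊢ₜ-identity α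
deduction {α = α} (mp t u s)               = mp-under α (deduction t) (deduction u) s

theorem4p14 : (Σ' : FmSet) (α β : Fm) →
    ((Σ' ,, α) ⊢ β → Σ' ⊢ (α ⟶ β))
    × (Σ' ⊢ (α ⟶ β) → α ⊆var β → (Σ' ,, α) ⊢ β)
theorem4p14 Σ' α β =
  (λ d → ⊢ₜ⇒⊢ (deduction (⊢⇒⊢ₜ d))) ,
  (λ d α⊆β → ⊢ₜ⇒⊢ (mp (assumption (inj₂ refl)) (weaken (⊢⇒⊢ₜ d)) α⊆β))
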